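{- Let $(T,\beta)$ be a vertex-cut tree of a connected graph $\mathcal{G}$, let $z^*\in V(T)$, and define $\alpha:V(T)\to2^{V(\mathcal{G})}$ by $\alpha(z^*)=\beta(z^*)$ and $\alpha(z)=\beta(z)\setminus\beta(z,z^*]$ for $z\ne z^*$. Then for every $z\in V(T)$ and every component $T'$ of $T-z$, $$\alpha(V(T'))=\begin{cases}\beta(V(T')) & \text{if } z^*\in V(T'),\\ \beta(V(T'))\setminus\beta(z) & \text{if } z^*\notin V(T').\end{cases}$$
   Context: Graphs are finite. For a map $f:A\to2^B$ and $X\subseteq A$, $f(X)=\bigcup_{x\in X}f(x)$. For vertices $x,y$ of a tree $T$, $(x,y]$ is the set of vertices on the path from $x$ to $y$ in $T$, including $y$ but not $x$, and $\beta(x,y]=\bigcup_{z\in(x,y]}\beta(z)$. For $W\subseteq V(\mathcal{G})$, $N(W)$ is the set of vertices adjacent to some vertex of $W$; $(V_0,\ldots,V_\delta)$ is a star partition of $V(\mathcal{G})$ if the $V_i$ are pairwise disjoint (possibly empty) with union $V(\mathcal{G})$ and $N(V_i)\subseteq V_i\cup V_0$ for $i\ge1$. For $z$ of degree $\delta$ in $T$, $T_1^{(z)},\ldots,T_\delta^{(z)}$ are the components of $T-z$. A vertex-cut tree of a connected graph $\mathcal{G}$ is $(T,\beta)$, $T$ a tree, $\beta:V(T)\to2^{V(\mathcal{G})}$, such that (VC1) $\beta(V(T))=V(\mathcal{G})$; (VC2) $\beta(x)\cap\beta(y)\subseteq\beta(z)$ whenever $z$ lies on the path from $x$ to $y$ in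 $T$; (VC3) for each $z$ of degree $\delta$, $(\beta(z),V_1,\ldots,V_\delta)$ with $V_i=\beta(V(T_i^{(z)}))\setminus\beta(z)$ is a star partition of $V(\mathcal{G})$. -}

module Defs where

open import Data.Nat using (ℕ; _≥_)
open import Data.Fin using (Fin)
open import Data.Fin.Subset using (Subset; _∈_; _∉_)
open import Data.List using (List; []; _∷_; length)
open import Data.List.Relation.Unary.Unique.Propositional using (Unique)
import Data.List.Membership.Propositional as LM
open import Data.Product using (Σ; ∃; _×_; _,_)
open import Data.Sum using (_⊎_)
import Data.Empty
open import Relation.Nullary using (¬_)
open import Relation.Binary using (Decidable; Symmetric)
open import Relation.Binary.PropositionalEquality using (_≡_; _≢_)
open import Function.Bundles using (_⇔_)

record Graph (n : ℕ) : Set₁ where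
  field
    Adj    : Fin n → Fin n → Set
    adj?   : Decidable Adj
    sym    : Symmetric Adj
    irrefl : ∀ x → ¬ Adj x x
open Graph public

module _ {n : ℕ} (G : Graph n) where

  data Walk : Fin n → Fin n → Set where
    stop : ∀ x → Walk x x
    step : ∀ {x y z} → Adj G x y → Walk y z → Walk x z

  verts : ∀ {x y} → Walk x y → List (Fin n)
  verts (stop x) = x ∷ []
  verts (step {x} _ w) = x ∷ verts w

  IsPath : ∀ {x y} → Walk x y → Set
  IsPath w = Unique (verts w)

  Connected : Set
  Connected = ∀ x y → Walk x y

  Acyclic : Set
  Acyclic = ∀ {x y} (w : Walk x y) → IsPath w → length (verts w) ≥ 3 → ¬ Adj G y x

  IsTree : Set
  IsTree = Connected × Acyclic

  -- z lies on the path from x to y (in a tree this path is unique)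
  OnPath : Fin n → Fin n → Fin n → Set
  OnPath x y z = Σ (Walk x y) λ w → IsPath w × LM._∈_ z (verts w)

  HalfOpen : Fin n → Fin n → Fin n → Set
  HalfOpen x y z = OnPath x y z × z ≢ x

  SameComp : Fin n → Fin n → Fin n → Set
  SameComp z u v = Σ (Walk u v) λ w → ¬ LM._∈_ z (verts w)

module _ {n m : ℕ} (G : Graph n) (T : Graph m) (β : Fin m → Subset n) where

  βimg : (Fin m → Set) → Fin n → Set
  βimg X v = ∃ λ t → X t × v ∈ β t

  -- V(T') for the component T' of T - z containing w (w ≢ z);
  -- every component of T - z is of this form
  Comp : Fin m → Fin m → Fin m → Set
  Comp z w = SameComp T z w

  Side : Fin m → Fin m → Fin n → Set
  Side z w v = (βimg (Comp z w) v) × v ∉ β z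

  record IsVertexCutTree : Set where
    field
      tree : IsTree T
      vc1 : ∀ v → ∃ λ t → v ∈ β t
      vc2 : ∀ x y z v → OnPath T x y z → v ∈ β x → v ∈ β y → v ∈ β z
      -- (VC3): (β(z), V_1, …, V_δ) is a star partition of V(G)
      vc3-cover    : ∀ z v → v ∈ β z ⊎ (∃ λ w → w ≢ z × Side z w v)
      vc3-disjoint : ∀ z w w' → w ≢ z → w' ≢ z → ¬ SameComp T z w w' →
                     ∀ v → Side z w v → Side z w' v → Data.Empty.⊥
      vc3-nbhd     : ∀ z w → w ≢ z → ∀ u v → Side z w u → Adj G u v →
                     Side z w v ⊎ v ∈ β z

  α : Fin m → Fin m → Fin n → Set
  α z* z v = (z ≡ z* × v ∈ β z*)
           ⊎ (z ≢ z* × v ∈ β z × ¬ (∃ λ t → HalfOpen T z z* t × v ∈ β t))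

  αimg : Fin m → (Fin m → Set) → Fin n → Set
  αimg z* X v = ∃ λ t → X t × α z* t v

module Submission where

-- Fix a vertex v of G and a node t of T with v ∈ β(t).
-- Follow the unique tree path P from t to z* and stop at the LAST node t'
-- of P whose bag contains v.  No node of (t', z*] contains v, so v ∈ α(t')
-- (paths in a tree are unique, hence (t', z*] is exactly the rest of P).
-- Moreover t' stays in the component T' of T - z containing t:
--   * if z* ∈ T', the path P can be chosen inside T', so it avoids z;
--   * if z* ∉ T' and v ∉ β(z), the piece of P from t to t' avoids z,
--     for otherwise (VC2) would put v into β(z).
-- This gives β(T') ⊆ α(T') resp. β(T') ∖ β(z) ⊆ α(T'); the converse
-- inclusions hold because α(t) ⊆ β(t), and, when z* ∉ T', every path
-- from T' to z* runs through z, so β(z) is removed from α(t) for t ∈ T'.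

open import Defs
open import Data.Nat using (ℕ; _≥_; s≤s; z≤n)
open import Data.Fin using (Fin)
open import Data.Fin.Subset using (Subset; _∉_)
import Data.Fin.Subset as Subset
import Data.Fin.Subset.Properties as Subset
open import Data.Fin.Properties using (_≟_)
open import Data.Product using (_×_; Σ; _,_; proj₁; proj₂)
open import Data.Sum using (_⊎_; inj₁; inj₂)
open import Data.Empty using (⊥; ⊥-elim)
open import Data.List using (List; []; _∷_; length)
open import Data.List.Relation.Unary.Any using (here; there)
open import Data.List.Relation.Unary.All using (All; []; _∷_; lookup)
open import Data.List.Relation.Unary.All.Properties using (All¬⇒¬Any; ¬Any⇒All¬)
open import Data.List.Relation.Unary.AllPairs using ([]; _∷_)
open import Data.List.Membership.Propositional using (_∈_)
import Data.List.Membership.DecPropositional as DecMembership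
open import Relation.Nullary using (¬_; yes; no; contradiction)
open import Level using (0ℓ)
open import Relation.Unary using (Pred; Decidable)
open import Relation.Binary.PropositionalEquality using (_≢_; _≡_; refl; subst; cong)
open import Function.Bundles using (_⇔_; mk⇔)

module Walks {n : ℕ} (G : Graph n) where
  open DecMembership (_≟_ {n}) using (_∈?_)

  head∈ : ∀ {a b} (W : Walk G a b) → a ∈ verts G W
  head∈ (stop _)   = here refl
  head∈ (step _ _) = here refl

  last∈ : ∀ {a b} (W : Walk G a b) → b ∈ verts G W
  last∈ (stop _)   = here refl
  last∈ (step _ W) = there (last∈ W)

  verts-nonempty : ∀ {a b} (W : Walk G a b) → length (verts G W) ≥ 1
  verts-nonempty (stop _)   = s≤s z≤n
  verts-nonempty (step _ _) = s≤s z≤n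

  tailVerts : ∀ {a b} → Walk G a b → List (Fin n)
  tailVerts (stop _)   = []
  tailVerts (step _ W) = verts G W

  tailVerts-∈ : ∀ {a b u} (W : Walk G a b) → u ∈ verts G W → u ≢ a → u ∈ tailVerts W
  tailVerts-∈ (stop _)   (here refl) u≢a = contradiction refl u≢a
  tailVerts-∈ (step _ _) (here refl) u≢a = contradiction refl u≢a
  tailVerts-∈ (step _ W) (there u∈W) _   = u∈W

  infixr 5 _++W_
  _++W_ : ∀ {a b c} → Walk G a b → Walk G b c → Walk G a c
  stop _   ++W W₂ = W₂
  step e W ++W W₂ = step e (W ++W W₂)

  ++W-∈ : ∀ {a b c x} (W₁ : Walk G a b) (W₂ : Walk G b c) →
          x ∈ verts G (W₁ ++W W₂) → x ∈ verts G W₁ ⊎ x ∈ verts G W₂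
  ++W-∈ (stop _)    W₂ x∈      = inj₂ x∈
  ++W-∈ (step _ W₁) W₂ (here refl) = inj₁ (here refl)
  ++W-∈ (step _ W₁) W₂ (there x∈) with ++W-∈ W₁ W₂ x∈
  ... | inj₁ x∈W₁ = inj₁ (there x∈W₁)
  ... | inj₂ x∈W₂ = inj₂ x∈W₂

  ++W-avoid : ∀ {a b c x} (W₁ : Walk G a b) (W₂ : Walk G b c) →
              ¬ x ∈ verts G W₁ → ¬ x ∈ verts G W₂ → ¬ x ∈ verts G (W₁ ++W W₂)
  ++W-avoid W₁ W₂ x∉W₁ x∉W₂ x∈ with ++W-∈ W₁ W₂ x∈
  ... | inj₁ x∈W₁ = x∉W₁ x∈W₁
  ... | inj₂ x∈W₂ = x∉W₂ x∈W₂

  reverse : ∀ {a b} → Walk G a b → Walk G b a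
  reverse (stop a)   = stop a
  reverse (step e W) = reverse W ++W step (Graph.sym G e) (stop _)

  reverse-∈ : ∀ {a b x} (W : Walk G a b) → x ∈ verts G (reverse W) → x ∈ verts G W
  reverse-∈ (stop _) x∈ = x∈
  reverse-∈ (step e W) x∈ with ++W-∈ (reverse W) (step (Graph.sym G e) (stop _)) x∈
  ... | inj₁ x∈W                 = there (reverse-∈ W x∈W)
  ... | inj₂ (here refl)         = there (head∈ W)
  ... | inj₂ (there (here refl)) = here refl

  takeTo : ∀ {a b u} (W : Walk G a b) → u ∈ verts G W → Walk G a u
  takeTo (stop a)   (here refl) = stop a
  takeTo (step e W) (here refl) = stop _
  takeTo (step e W) (there u∈)  = step e (takeTo W u∈)

  takeTo-⊆ : ∀ {a b u x} (W : Walk G a b) (u∈ : u ∈ verts G W) →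
             x ∈ verts G (takeTo W u∈) → x ∈ verts G W
  takeTo-⊆ (stop a)   (here refl) x∈          = x∈
  takeTo-⊆ (step e W) (here refl) (here refl) = here refl
  takeTo-⊆ (step e W) (there u∈)  (here refl) = here refl
  takeTo-⊆ (step e W) (there u∈)  (there x∈)  = there (takeTo-⊆ W u∈ x∈)

  takeTo-path : ∀ {a b u} (W : Walk G a b) (u∈ : u ∈ verts G W) →
                IsPath G W → IsPath G (takeTo W u∈)
  takeTo-path (stop a)   (here refl) p = p
  takeTo-path (step e W) (here refl) p = [] ∷ []
  takeTo-path (step e W) (there u∈) (a∉W ∷ p) =
    ¬Any⇒All¬ _ (λ a∈ → All¬⇒¬Any a∉W (takeTo-⊆ W u∈ a∈)) ∷ takeTo-path W u∈ p

  dropTo : ∀ {a b u} (W : Walk G a b) → u ∈ verts G W → Walk G u b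
  dropTo (stop a)   (here refl) = stop a
  dropTo (step e W) (here refl) = step e W
  dropTo (step e W) (there u∈)  = dropTo W u∈

  dropTo-⊆ : ∀ {a b u x} (W : Walk G a b) (u∈ : u ∈ verts G W) →
             x ∈ verts G (dropTo W u∈) → x ∈ verts G W
  dropTo-⊆ (stop a)   (here refl) x∈ = x∈
  dropTo-⊆ (step e W) (here refl) x∈ = x∈
  dropTo-⊆ (step e W) (there u∈)  x∈ = there (dropTo-⊆ W u∈ x∈)

  dropTo-path : ∀ {a b u} (W : Walk G a b) (u∈ : u ∈ verts G W) →
                IsPath G W → IsPath G (dropTo W u∈)
  dropTo-path (stop a)   (here refl) p       = p
  dropTo-path (step e W) (here refl) p       = p
  dropTo-path (step e W) (there u∈)  (_ ∷ p) = dropTo-path W u∈ p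

  toPath : ∀ {a b} (W : Walk G a b) →
           Σ (Walk G a b) λ P → IsPath G P × (∀ {x} → x ∈ verts G P → x ∈ verts G W)
  toPath (stop a) = stop a , [] ∷ [] , λ x∈ → x∈
  toPath (step {a} e W) with toPath W
  ... | P , P-path , P⊆W with a ∈? verts G P
  ... | yes a∈P = dropTo P a∈P , dropTo-path P a∈P P-path ,
                  λ x∈ → there (P⊆W (dropTo-⊆ P a∈P x∈))
  ... | no a∉P  = step e P , ¬Any⇒All¬ _ a∉P ∷ P-path ,
                  λ { (here refl) → here refl ; (there x∈) → there (P⊆W x∈) }

  record LastHit (Q : Pred (Fin n) 0ℓ) {a b : Fin n} (P : Walk G a b) : Set where
    field
      point      : Fin n
      onPath     : point ∈ verts G P
      rest       : Walk G point b
      restPath   : IsPath G rest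
      hit        : Q point
      clearAfter : All (λ u → ¬ Q u) (tailVerts rest)

  lastHit : (Q : Pred (Fin n) 0ℓ) → Decidable Q →
            ∀ {a b} (P : Walk G a b) → IsPath G P →
            All (λ u → ¬ Q u) (verts G P) ⊎ LastHit Q P
  lastHit Q Q? (stop b) _ with Q? b
  ... | yes Qb = inj₂ (record { point = b ; onPath = here refl ; rest = stop b
                              ; restPath = [] ∷ [] ; hit = Qb ; clearAfter = [] })
  ... | no ¬Qb = inj₁ (¬Qb ∷ [])
  lastHit Q Q? (step {a} e P) p@(_ ∷ P-path) with lastHit Q Q? P P-path
  ... | inj₂ h = inj₂ (record { point = point ; onPath = there onPath ; rest = rest
                              ; restPath = restPath ; hit = hit ; clearAfter = clearAfter })
    where open LastHit h
  ... | inj₁ none with Q? a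
  ...   | yes Qa = inj₂ (record { point = a ; onPath = here refl ; rest = step e P
                                ; restPath = p ; hit = Qa ; clearAfter = none })
  ...   | no ¬Qa = inj₁ (¬Qa ∷ none)

  lastHit-from-start : (Q : Pred (Fin n) 0ℓ) → Decidable Q →
                       ∀ {a b} (P : Walk G a b) → IsPath G P → Q a → LastHit Q P
  lastHit-from-start Q Q? P P-path Qa with lastHit Q Q? P P-path
  ... | inj₁ none = contradiction Qa (lookup none (head∈ P))
  ... | inj₂ h    = h

module UniquePaths {n : ℕ} (G : Graph n) (acyclic : Acyclic G) where
  open Walks G

  -- Two paths leaving x that avoid x afterwards and meet at y start with
  -- the same edge: otherwise they close a cycle through x.
  sameFirstStep : ∀ {x p q y} → Adj G x p → Adj G x q →
                  (P : Walk G p y) → IsPath G P → ¬ x ∈ verts G P →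
                  (Q : Walk G q y) → IsPath G Q → ¬ x ∈ verts G Q → p ≡ q
  sameFirstStep {x} {p} {q} xp xq P _ x∉P Q _ x∉Q with p ≟ q
  ... | yes p≡q = p≡q
  ... | no p≢q with toPath (Q ++W reverse P)
  ...   | R , R-path , R⊆ = ⊥-elim (closeCycle R R-path x∉R)
    where
    x∉R : ¬ x ∈ verts G R
    x∉R x∈ = ++W-avoid Q (reverse P) x∉Q (λ x∈P' → x∉P (reverse-∈ P x∈P')) (R⊆ x∈)

    closeCycle : (R : Walk G q p) → IsPath G R → ¬ x ∈ verts G R → ⊥
    closeCycle (stop _) _ _ = p≢q refl
    closeCycle R@(step _ R') R-path x∉R =
      acyclic (step xq R) (¬Any⇒All¬ _ x∉R ∷ R-path)
              (s≤s (s≤s (verts-nonempty R'))) (Graph.sym G xp)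

  pathsUnique : ∀ {x y} (P Q : Walk G x y) → IsPath G P → IsPath G Q →
                verts G P ≡ verts G Q
  pathsUnique (stop _)   (stop _)   _ _ = refl
  pathsUnique (stop _)   (step _ Q) _ (x∉Q ∷ _) = ⊥-elim (All¬⇒¬Any x∉Q (last∈ Q))
  pathsUnique (step _ P) (stop _)   (x∉P ∷ _) _ = ⊥-elim (All¬⇒¬Any x∉P (last∈ P))
  pathsUnique (step e P) (step f Q) (x∉P ∷ P-path) (x∉Q ∷ Q-path)
    with sameFirstStep e f P P-path (All¬⇒¬Any x∉P) Q Q-path (All¬⇒¬Any x∉Q)
  ... | refl = cong (_ ∷_) (pathsUnique P Q P-path Q-path)

module Components {n : ℕ} (G : Graph n) (z : Fin n) where
  open Walks G
  open DecMembership (_≟_ {n}) using (_∈?_)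

  extend : ∀ {w a b} → SameComp G z w a → (W : Walk G a b) → ¬ z ∈ verts G W →
           SameComp G z w b
  extend (Wa , z∉Wa) W z∉W = Wa ++W W , ++W-avoid Wa W z∉Wa z∉W

  member≢cut : ∀ {w a} → SameComp G z w a → z ≢ a
  member≢cut (Wa , z∉Wa) refl = z∉Wa (last∈ Wa)

  exit-through-cut : ∀ {w a b} → SameComp G z w a → ¬ SameComp G z w b →
                     (W : Walk G a b) → z ∈ verts G W
  exit-through-cut a∈C b∉C W with z ∈? verts G W
  ... | yes z∈W = z∈W
  ... | no z∉W  = contradiction (extend a∈C W z∉W) b∉C

module Lemma {n m : ℕ} (G : Graph n) (T : Graph m) (β : Fin m → Subset n)
             (vct : IsVertexCutTree G T β) (z* : Fin m) (v : Fin n) where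
  open IsVertexCutTree vct
  open Walks T
  open UniquePaths T (proj₂ tree)

  α⊆β : ∀ {t} → α G T β z* t v → v Subset.∈ β t
  α⊆β (inj₁ (refl , v∈)) = v∈
  α⊆β (inj₂ (_ , v∈ , _)) = v∈

  -- If v ∈ β(t') and no bag after t' on the path S from t' to z* contains
  -- v, then v ∈ α(t'): by uniqueness of paths, (t', z*] is the tail of S.
  α-at-last-bag : ∀ {t'} (S : Walk T t' z*) → IsPath T S → v Subset.∈ β t' →
                  All (λ u → v ∉ β u) (tailVerts S) → α G T β z* t' v
  α-at-last-bag {t'} S S-path v∈ clear with t' ≟ z*
  ... | yes refl = inj₁ (refl , v∈)
  ... | no t'≢z* = inj₂ (t'≢z* , v∈ , notBeyond)
    where
    notBeyond : ¬ Σ (Fin m) λ u → HalfOpen T t' z* u × v Subset.∈ β u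
    notBeyond (u , ((Q , Q-path , u∈Q) , u≢t') , v∈u) =
      lookup clear (tailVerts-∈ S (subst (u ∈_) (pathsUnique Q S Q-path S-path) u∈Q) u≢t') v∈u

  lastBag : ∀ {t} (P : Walk T t z*) → IsPath T P → v Subset.∈ β t →
            Σ (Fin m) λ t' → Σ (t' ∈ verts T P) λ _ → α G T β z* t' v
  lastBag P P-path v∈ = point , onPath , α-at-last-bag rest restPath hit clearAfter
    where
    open LastHit (lastHit-from-start (λ u → v Subset.∈ β u) (λ u → v Subset.∈? β u) P P-path v∈)

  module _ (z w : Fin m) where
    open Components T z

    rootSide : SameComp T z w z* →
               αimg G T β z* (Comp G T β z w) v ⇔ βimg G T β (Comp G T β z w) v
    rootSide z*∈C = mk⇔ (λ { (t , t∈C , v∈α) → t , t∈C , α⊆β v∈α }) fromβ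
      where
      fromβ : βimg G T β (Comp G T β z w) v → αimg G T β z* (Comp G T β z w) v
      fromβ (t , t∈C@(Wt , z∉Wt) , v∈t) with toPath (reverse Wt ++W proj₁ z*∈C)
      ... | P , P-path , P⊆ with lastBag P P-path v∈t
      ... | t' , t'∈P , v∈α = t' , extend t∈C (takeTo P t'∈P) z∉prefix , v∈α
        where
        z∉prefix : ¬ z ∈ verts T (takeTo P t'∈P)
        z∉prefix z∈ = ++W-avoid (reverse Wt) (proj₁ z*∈C)
                        (λ z∈' → z∉Wt (reverse-∈ Wt z∈')) (proj₂ z*∈C)
                        (P⊆ (takeTo-⊆ P t'∈P z∈))

    farSide : ¬ SameComp T z w z* →
              αimg G T β z* (Comp G T β z w) v ⇔ (βimg G T β (Comp G T β z w) v × v ∉ β z)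
    farSide z*∉C = mk⇔ toβ fromβ
      where
      toβ : αimg G T β z* (Comp G T β z w) v → βimg G T β (Comp G T β z w) v × v ∉ β z
      toβ (t , t∈C , inj₁ (refl , _)) = contradiction t∈C z*∉C
      toβ (t , t∈C , inj₂ (_ , v∈t , notBeyond)) = (t , t∈C , v∈t) , λ v∈z →
        notBeyond (z , ((P , P-path , exit-through-cut t∈C z*∉C P) , member≢cut t∈C) , v∈z)
        where
        P = proj₁ (toPath (proj₁ tree t z*))
        P-path = proj₁ (proj₂ (toPath (proj₁ tree t z*)))

      fromβ : βimg G T β (Comp G T β z w) v × v ∉ β z → αimg G T β z* (Comp G T β z w) v
      fromβ ((t , t∈C , v∈t) , v∉z) with toPath (proj₁ tree t z*)
      ... | P , P-path , _ with lastBag P P-path v∈t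
      ... | t' , t'∈P , v∈α = t' , extend t∈C (takeTo P t'∈P) z∉prefix , v∈α
        where
        -- a cut node on the path t … t' would contain v by (VC2)
        z∉prefix : ¬ z ∈ verts T (takeTo P t'∈P)
        z∉prefix z∈ = v∉z (vc2 t t' z v (takeTo P t'∈P , takeTo-path P t'∈P P-path , z∈)
                               v∈t (α⊆β v∈α))

lemma6p2 : ∀ {n m} (G : Graph n) (T : Graph m) (β : Fin m → Subset n) →
    Connected G → IsVertexCutTree G T β →
    ∀ (z* z w : Fin m) → w ≢ z →
    (SameComp T z w z* →
    ∀ v → (αimg G T β z* (Comp G T β z w) v
    ⇔ βimg G T β (Comp G T β z w) v))
    × (¬ SameComp T z w z* →
    ∀ v → (αimg G T β z* (Comp G T β z w) v
    ⇔ (βimg G T β (Comp G T β z w) v × v ∉ β z)))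
lemma6p2 G T β _ vct z* z w _ =
  (λ z*∈C v → Lemma.rootSide G T β vct z* v z w z*∈C) ,
  (λ z*∉C v → Lemma.farSide G T β vct z* v z w z*∉C)
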